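{- For all positive integers $n,k,s$ with $n\geq ks$, we have $\operatorname{ar}(n,k,M_s)\geq \operatorname{ex}(n,k,M_{s-1})+2$.
   Context: An $s$-matching $M_s$ in a $k$-uniform hypergraph is a set of $s$ pairwise disjoint edges. In an edge-coloring, a subgraph is rainbow if all its edges receive distinct colors. The anti-Ramsey number $\operatorname{ar}(n,k,G)$ of a $k$-uniform hypergraph $G$ is the smallest integer $c$ such that every edge-coloring of the complete $n$-vertex $k$-uniform hypergraph using exactly $c$ colors contains a rainbow copy of $G$. The Turán number $\operatorname{ex}(n,k,G)$ is the maximum number of edges in an $n$-vertex $k$-uniform hypergraph containing no copy of $G$. -}

module Defs where

open import Data.Nat using (ℕ; _≤_; _<_; _+_)
open import Data.Fin using (Fin)
open import Data.Fin.Subset using (Subset; ∣_∣; _∩_; Empty)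
open import Data.List using (List; length)
open import Data.List.Membership.Propositional using (_∈_)
open import Data.List.Relation.Unary.Unique.Propositional using (Unique)
open import Data.List.Relation.Unary.All using (All)
open import Data.Product using (Σ; _×_; ∃)
open import Relation.Binary.PropositionalEquality using (_≡_; _≢_)
open import Relation.Nullary using (¬_)

IsEdge : (n k : ℕ) → Subset n → Set
IsEdge n k e = ∣ e ∣ ≡ k

PairwiseDisjoint : {n s : ℕ} → (Fin s → Subset n) → Set
PairwiseDisjoint {s = s} M = (i j : Fin s) → i ≢ j → Empty (M i ∩ M j)

record Hypergraph (n k : ℕ) : Set where
  field
    edges    : List (Subset n)
    uniform  : All (IsEdge n k) edges
    distinct : Unique edges
open Hypergraph public

numEdges : {n k : ℕ} → Hypergraph n k → ℕ
numEdges H = length (edges H)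

ContainsMatching : {n k : ℕ} → ℕ → Hypergraph n k → Set
ContainsMatching {n} s H =
  Σ (Fin s → Subset n) λ M → ((i : Fin s) → M i ∈ edges H) × PairwiseDisjoint M

-- m = ex(n,k,M_s): the maximum number of edges of an n-vertex k-uniform
-- hypergraph with no copy of M_s (attained, and an upper bound).
IsTuranMatching : (n k s m : ℕ) → Set
IsTuranMatching n k s m =
  (Σ (Hypergraph n k) λ H → ¬ ContainsMatching s H × numEdges H ≡ m)
  × ((H : Hypergraph n k) → ¬ ContainsMatching s H → numEdges H ≤ m)

-- The colouring is a function on all subsets; only its values
-- on k-edges matter.
UsesExactly : (n k c : ℕ) → (Subset n → Fin c) → Set
UsesExactly n k c χ = (a : Fin c) → ∃ λ e → IsEdge n k e × χ e ≡ a

HasRainbowMatching : (n k s c : ℕ) → (Subset n → Fin c) → Set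
HasRainbowMatching n k s c χ =
  Σ (Fin s → Subset n) λ M →
    ((i : Fin s) → IsEdge n k (M i)) × PairwiseDisjoint M
    × ((i j : Fin s) → i ≢ j → χ (M i) ≢ χ (M j))

ForcesRainbow : (n k s c : ℕ) → Set
ForcesRainbow n k s c =
  (χ : Subset n → Fin c) → UsesExactly n k c χ → HasRainbowMatching n k s c χ

-- a = ar(n,k,M_s): the smallest positive c such that every colouring
-- using exactly c colours contains a rainbow M_s.
IsAntiRamseyMatching : (n k s a : ℕ) → Set
IsAntiRamseyMatching n k s a =
  1 ≤ a × ForcesRainbow n k s a
  × ((c : ℕ) → 1 ≤ c → c < a → ¬ ForcesRainbow n k s c)

-- Let H be an extremal hypergraph: ex(n,k,M_{s-1}) edges and no M_{s-1}.  For
-- every 1 ≤ c ≤ |H| + 1 there is a colouring with exactly c colours and no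
-- rainbow M_s: give c - 1 edges of H distinct colours and all other edges one
-- common colour.
-- A rainbow M_s meets that common colour at most once, so s - 1 of its edges
-- lie in H, which is impossible.  The common colour really occurs because the
-- s - 1 disjoint blocks of k consecutive vertices are not all edges of H.
module Submission where

open import Defs
open import Data.Bool using (true; false; _∧_; if_then_else_)
import Data.Bool.Properties as Bool
open import Data.Fin using (Fin; zero; suc; punchIn)
import Data.Fin.Properties as Fin
open import Data.Fin.Subset using (Subset; ∣_∣; _∩_; Empty; ⊥; ⊤)
open import Data.Fin.Subset.Properties using (∉⊥; ∣⊥∣≡0; ∣⊤∣≡n; ∩-zeroˡ; ∩-zeroʳ; ∩-comm; Empty-unique)
open import Data.List using (List; []; _∷_; length)
open import Data.List.Membership.Propositional using (_∈_; _∉_)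
import Data.List.Membership.DecPropositional as DecMembership
open import Data.List.Relation.Unary.All using (lookup)
open import Data.List.Relation.Unary.AllPairs using (_∷_)
open import Data.List.Relation.Unary.Any using (here; there)
open import Data.List.Relation.Unary.Unique.Propositional using (Unique)
open import Data.Nat using (ℕ; zero; suc; _≤_; _<_; _+_; _*_; _∸_; s≤s)
open import Data.Nat.Properties using (+-comm; *-comm; +-identityʳ; ≰⇒>; m+n≤o⇒m≤o; m+n≤o⇒n≤o; +-cancelˡ-≤; m≤n⇒∃[o]m+o≡n)
open import Data.Product using (Σ; _×_; ∃; _,_)
open import Data.Vec using ([]; _∷_; _++_)
open import Data.Vec.Properties using (≡-dec; zipWith-++)
open import Function using (_∘_)
open import Relation.Binary.Definitions using (DecidableEquality)
open import Relation.Binary.PropositionalEquality using (_≡_; _≢_; refl; sym; trans; cong; cong₂; subst; module ≡-Reasoning)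
open import Relation.Nullary using (¬_; Dec; yes; no; contradiction)
open import Relation.Nullary.Decidable using (does; dec-true; dec-false; decidable-stable)

_≟ˢ_ : ∀ {n} → DecidableEquality (Subset n)
_≟ˢ_ = ≡-dec Bool._≟_

_∈?_ : ∀ {n} (e : Subset n) (L : List (Subset n)) → Dec (e ∈ L)
_∈?_ = DecMembership._∈?_ _≟ˢ_

∣p++q∣≡∣p∣+∣q∣ : ∀ {k o} (p : Subset k) (q : Subset o) → ∣ p ++ q ∣ ≡ ∣ p ∣ + ∣ q ∣
∣p++q∣≡∣p∣+∣q∣ []          q = refl
∣p++q∣≡∣p∣+∣q∣ (true ∷ p)  q = cong suc (∣p++q∣≡∣p∣+∣q∣ p q)
∣p++q∣≡∣p∣+∣q∣ (false ∷ p) q = ∣p++q∣≡∣p∣+∣q∣ p q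

⊥++⊥≡⊥ : ∀ k {o} → ⊥ {k} ++ ⊥ {o} ≡ ⊥
⊥++⊥≡⊥ zero    = refl
⊥++⊥≡⊥ (suc k) = cong (false ∷_) (⊥++⊥≡⊥ k)

≡⊥⇒Empty : ∀ {n} {p : Subset n} → p ≡ ⊥ → Empty p
≡⊥⇒Empty refl (_ , x∈⊥) = ∉⊥ x∈⊥

∩-++ : ∀ {k o} (p p′ : Subset k) (q q′ : Subset o) → (p ++ q) ∩ (p′ ++ q′) ≡ (p ∩ p′) ++ (q ∩ q′)
∩-++ p p′ q q′ = zipWith-++ _∧_ p q p′ q′

disjointSubsets : ∀ k t n → t * k ≤ n →
  Σ (Fin t → Subset n) λ B → ((i : Fin t) → ∣ B i ∣ ≡ k) × PairwiseDisjoint B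
disjointSubsets k zero    n _   = (λ ()) , (λ ()) , (λ ())
disjointSubsets k (suc t) n t*k≤n with m≤n⇒∃[o]m+o≡n (m+n≤o⇒m≤o k t*k≤n)
... | o , refl with disjointSubsets k t o (+-cancelˡ-≤ k _ _ t*k≤n)
... | B′ , ∣B′∣≡k , B′-disjoint = B , ∣B∣≡k , B-disjoint
  where
  open ≡-Reasoning

  B : Fin (suc t) → Subset (k + o)
  B zero    = ⊤ {k} ++ ⊥
  B (suc i) = ⊥ {k} ++ B′ i

  ∣B∣≡k : (i : Fin (suc t)) → ∣ B i ∣ ≡ k
  ∣B∣≡k zero = begin
    ∣ ⊤ {k} ++ ⊥ {o} ∣    ≡⟨ ∣p++q∣≡∣p∣+∣q∣ (⊤ {k}) ⊥ ⟩
    ∣ ⊤ {k} ∣ + ∣ ⊥ {o} ∣ ≡⟨ cong₂ _+_ (∣⊤∣≡n k) (∣⊥∣≡0 o) ⟩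
    k + 0                 ≡⟨ +-identityʳ k ⟩
    k                     ∎
  ∣B∣≡k (suc i) = trans (∣p++q∣≡∣p∣+∣q∣ (⊥ {k}) (B′ i)) (cong₂ _+_ (∣⊥∣≡0 k) (∣B′∣≡k i))

  B₀∩B₊≡⊥ : (j : Fin t) → B zero ∩ B (suc j) ≡ ⊥
  B₀∩B₊≡⊥ j = begin
    B zero ∩ B (suc j)     ≡⟨ ∩-++ ⊤ ⊥ ⊥ (B′ j) ⟩
    (⊤ ∩ ⊥) ++ (⊥ ∩ B′ j)  ≡⟨ cong₂ _++_ (∩-zeroʳ (⊤ {k})) (∩-zeroˡ (B′ j)) ⟩
    ⊥ {k} ++ ⊥             ≡⟨ ⊥++⊥≡⊥ k ⟩
    ⊥                      ∎

  B-disjoint : PairwiseDisjoint B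
  B-disjoint zero    zero    0≢0 = contradiction refl 0≢0
  B-disjoint zero    (suc j) _   = ≡⊥⇒Empty (B₀∩B₊≡⊥ j)
  B-disjoint (suc i) zero    _   = ≡⊥⇒Empty (trans (∩-comm (B (suc i)) (B zero)) (B₀∩B₊≡⊥ i))
  B-disjoint (suc i) (suc j) i≢j = ≡⊥⇒Empty (begin
    B (suc i) ∩ B (suc j)     ≡⟨ ∩-++ ⊥ ⊥ (B′ i) (B′ j) ⟩
    (⊥ ∩ ⊥) ++ (B′ i ∩ B′ j)  ≡⟨ cong₂ _++_ (∩-zeroˡ (⊥ {k}))
                                    (Empty-unique (B′-disjoint i j (i≢j ∘ cong suc))) ⟩
    ⊥ {k} ++ ⊥                ≡⟨ ⊥++⊥≡⊥ k ⟩
    ⊥                         ∎)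

nonEdge : ∀ {n k} t (H : Hypergraph n k) → t * k ≤ n → ¬ ContainsMatching t H →
  ∃ λ e → IsEdge n k e × e ∉ edges H
nonEdge {n} {k} t H t*k≤n H∌Mₜ with disjointSubsets k t n t*k≤n
... | B , ∣B∣≡k , B-disjoint with Fin.all? (λ i → B i ∈? edges H)
... | yes B⊆H = contradiction (B , B⊆H , B-disjoint) H∌Mₜ
... | no B⊈H with Fin.¬∀⟶∃¬ t _ (λ i → B i ∈? edges H) B⊈H
... | i , Bᵢ∉H = B i , ∣B∣≡k i , Bᵢ∉H

PairwiseDisjoint-punchIn : ∀ {n t} {M : Fin (suc t) → Subset n} (i : Fin (suc t)) →
  PairwiseDisjoint M → PairwiseDisjoint (M ∘ punchIn i)
PairwiseDisjoint-punchIn i M-disjoint j j′ j≢j′ =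
  M-disjoint (punchIn i j) (punchIn i j′) (j≢j′ ∘ Fin.punchIn-injective i j j′)

injective⇒punchIn-avoids : ∀ {a} {A : Set a} {t} → DecidableEquality A →
  (c : Fin (suc t) → A) → (∀ i j → i ≢ j → c i ≢ c j) →
  (z : A) → ∃ λ i → ∀ j → c (punchIn i j) ≢ z
injective⇒punchIn-avoids _≟_ c c-injective z with Fin.any? (λ i → c i ≟ z)
... | yes (i , cᵢ≡z) = i , λ j cⱼ≡z →
  c-injective (punchIn i j) i (Fin.punchInᵢ≢i i j) (trans cⱼ≡z (sym cᵢ≡z))
... | no ∄i = zero , λ j cⱼ≡z → ∄i (suc j , cⱼ≡z)

-- The i-th set of L, for i < d, gets colour suc i and every other set colour 0;
-- punchIn 1 shifts the colours of the tail past the colour of the head.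
listColouring : ∀ {n} d → List (Subset n) → Subset n → Fin (suc d)
listColouring zero    _       _ = zero
listColouring (suc d) []      _ = zero
listColouring (suc d) (x ∷ L) e =
  if does (e ≟ˢ x) then suc zero else punchIn (suc zero) (listColouring d L e)

listColouring-head : ∀ {n} d (x : Subset n) L → listColouring (suc d) (x ∷ L) x ≡ suc zero
listColouring-head d x L rewrite dec-true (x ≟ˢ x) refl = refl

listColouring-tail : ∀ {n} d {x e : Subset n} L → e ≢ x →
  listColouring (suc d) (x ∷ L) e ≡ punchIn (suc zero) (listColouring d L e)
listColouring-tail d {x} {e} L e≢x rewrite dec-false (e ≟ˢ x) e≢x = refl

listColouring-∉ : ∀ {n} d {L} {e : Subset n} → e ∉ L → listColouring d L e ≡ zero
listColouring-∉ zero            _     = refl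
listColouring-∉ (suc d) {[]}    _     = refl
listColouring-∉ (suc d) {x ∷ L} e∉x∷L =
  trans (listColouring-tail d L (e∉x∷L ∘ here))
        (cong (punchIn (suc zero)) (listColouring-∉ d (e∉x∷L ∘ there)))

listColouring-≢0⇒∈ : ∀ {n} d L {e : Subset n} → listColouring d L e ≢ zero → e ∈ L
listColouring-≢0⇒∈ d L {e} c≢0 = decidable-stable (e ∈? L) (c≢0 ∘ listColouring-∉ d)

listColouring-onto : ∀ {n} d (L : List (Subset n)) → Unique L → d ≤ length L →
  (j : Fin d) → ∃ λ e → e ∈ L × listColouring d L e ≡ suc j
listColouring-onto (suc d) (x ∷ L) _ _ zero = x , here refl , listColouring-head d x L
listColouring-onto (suc d) (x ∷ L) (x∉L ∷ L-unique) (s≤s d≤|L|) (suc j) =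
  let e , e∈L , cₑ≡suc-j = listColouring-onto d L L-unique d≤|L| j
  in e , there e∈L ,
     trans (listColouring-tail d L (λ e≡x → lookup x∉L e∈L (sym e≡x)))
           (cong (punchIn (suc zero)) cₑ≡suc-j)

listColouring-usesExactly : ∀ {n k} d (H : Hypergraph n k) → d ≤ numEdges H →
  (∃ λ e → IsEdge n k e × e ∉ edges H) → UsesExactly n k (suc d) (listColouring d (edges H))
listColouring-usesExactly d H _ (e , e-edge , e∉H) zero = e , e-edge , listColouring-∉ d e∉H
listColouring-usesExactly d H d≤|H| _ (suc j)
  with listColouring-onto d (edges H) (distinct H) d≤|H| j
... | e , e∈H , cₑ≡suc-j = e , lookup (uniform H) e∈H , cₑ≡suc-j

listColouring-noRainbow : ∀ {n k t} d (H : Hypergraph n k) → ¬ ContainsMatching t H →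
  ¬ HasRainbowMatching n k (suc t) (suc d) (listColouring d (edges H))
listColouring-noRainbow d H H∌Mₜ (M , _ , M-disjoint , rainbow) =
  let i , avoids0 = injective⇒punchIn-avoids Fin._≟_ (listColouring d (edges H) ∘ M) rainbow zero
  in H∌Mₜ ( M ∘ punchIn i
          , (λ j → listColouring-≢0⇒∈ d (edges H) (avoids0 j))
          , PairwiseDisjoint-punchIn i M-disjoint )

¬ForcesRainbow : ∀ {n k} t d (H : Hypergraph n k) → t * k ≤ n → ¬ ContainsMatching t H →
  d ≤ numEdges H → ¬ ForcesRainbow n k (suc t) (suc d)
¬ForcesRainbow t d H t*k≤n H∌Mₜ d≤|H| forces =
  listColouring-noRainbow d H H∌Mₜ
    (forces _ (listColouring-usesExactly d H d≤|H| (nonEdge t H t*k≤n H∌Mₜ)))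

proposition3p1 : (n k s : ℕ) → 1 ≤ n → 1 ≤ k → 1 ≤ s → k * s ≤ n →
    (a m : ℕ) → IsAntiRamseyMatching n k s a → IsTuranMatching n k (s ∸ 1) m →
    m + 2 ≤ a
proposition3p1 n k (suc t) _ _ _ k*s≤n zero    m (() , _)
proposition3p1 n k (suc t) _ _ _ k*s≤n (suc d) m (_ , forces , _) ((H , H∌Mₜ , refl) , _) =
  subst (_≤ suc d) (+-comm 2 (numEdges H)) (s≤s |H|<d)
  where
  t*k≤n : t * k ≤ n
  t*k≤n = m+n≤o⇒n≤o k (subst (_≤ n) (*-comm k (suc t)) k*s≤n)

  |H|<d : numEdges H < d
  |H|<d = ≰⇒> (λ d≤|H| → ¬ForcesRainbow t d H t*k≤n H∌Mₜ d≤|H| forces)
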